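{- Let $X$ be a set of size $n$ and let $x_1,\dots,x_m$ be elements of $X$, not necessarily distinct. Then there exists a bijection $\sigma:X\to\{1,\dots,n\}$ such that for each $i=1,\dots,m$: (a) $\sigma(x_i)\le i$, and (b) for all $d=2,\dots,i$, if $\sigma(x_i)=d$ then $\sigma(x_j)=d-1$ for some $j\in\{1,\dots,i-1\}$. -}

module Defs where

open import Data.Nat using (ℕ; suc; _≤_; _<_; _∸_)
open import Data.Fin using (Fin; toℕ)
open import Data.Product using (∃; _×_)
open import Function.Bundles using (Bijection; _⤖_)
open import Relation.Binary.PropositionalEquality using (_≡_)

-- Elements of {1,…,n} are represented by Fin n; the 1-based value of k : Fin n
-- is suc (toℕ k).  Index i ∈ {1,…,m} is represented by i : Fin m with 1-based
-- value suc (toℕ i).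
val : ∀ {n} → Fin n → ℕ
val k = suc (toℕ k)

Good : ∀ {a} {X : Set a} {n m : ℕ} → (X → Fin n) → (Fin m → X) → Set
Good {m = m} σ x =
  (i : Fin m) →
    (val (σ (x i)) ≤ val i)
    × ((d : ℕ) → 2 ≤ d → d ≤ val i → val (σ (x i)) ≡ d →
         ∃ λ (j : Fin m) → (val j < val i) × (val (σ (x j)) ≡ d ∸ 1))

-- Label the values in order of first occurrence: the value first seen at position i
-- receives the smallest unused label, which is at most i, and every smaller label
-- already belongs to a value seen before i. The labelling is a permutation of Fin n
-- built one position at a time: a new value swaps its current label with the next
-- free one, which moves no label of an earlier value.

module Submission where

open import Defs
open import Data.Nat using (ℕ; zero; suc; _≤_; _<_; _∸_; s≤s; z≤n; _<?_)
open import Data.Nat.Properties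
  using (≤-refl; ≤-trans; ≤-<-trans; <⇒≤; <⇒≱; ≮⇒≥; <-irrefl; ≤-pred;
         n≤1+n; m≤n⇒m≤1+n; m<n⇒m<1+n; m<1+n⇒m<n∨m≡n; suc-injective)
open import Data.Fin using (Fin; toℕ; fromℕ<; _≟_)
open import Data.Fin.Properties using (toℕ-injective; toℕ<n; toℕ-fromℕ<)
open import Data.Fin.Permutation using (Permutation′; _⟨$⟩ʳ_; _∘ₚ_; transpose)
import Data.Fin.Permutation as Perm
import Data.Fin.Permutation.Components as PC
open import Data.Product using (∃; _×_; _,_)
open import Data.Sum using (_⊎_; inj₁; inj₂; map₂)
open import Function.Bundles using (Bijection; _⤖_)
open import Function.Properties.Inverse using (↔⇒⤖)
open import Function.Construct.Composition using (_⤖-∘_)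
open import Relation.Binary.PropositionalEquality
open import Relation.Nullary using (¬_; yes; no)
open import Relation.Nullary.Decidable using (dec-true; dec-false)

transpose-sends : ∀ {n} (a b : Fin n) → PC.transpose a b a ≡ b
transpose-sends a b rewrite dec-true (a ≟ a) refl = refl

transpose-fixes : ∀ {n} {a b c : Fin n} → c ≢ a → c ≢ b → PC.transpose a b c ≡ c
transpose-fixes {a = a} {b} {c} c≢a c≢b
  rewrite dec-false (c ≟ a) c≢a | dec-false (c ≟ b) c≢b = refl

GoodAt : ∀ {a} {X : Set a} {n m : ℕ} → (X → Fin n) → (Fin m → X) → Fin m → Set
GoodAt {m = m} σ x i =
  (val (σ (x i)) ≤ val i)
  × ((d : ℕ) → 2 ≤ d → d ≤ val i → val (σ (x i)) ≡ d →
       ∃ λ (j : Fin m) → (val j < val i) × (val (σ (x j)) ≡ d ∸ 1))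

module _ {a} {X : Set a} {n m : ℕ} (x : Fin m → X) where

  GoodAt-cong : ∀ (σ σ′ : X → Fin n) i →
                (∀ j → toℕ j ≤ toℕ i → σ (x j) ≡ σ′ (x j)) →
                GoodAt σ x i → GoodAt σ′ x i
  GoodAt-cong σ σ′ i agree (bounded , predecessor) =
    subst (λ z → val z ≤ val i) (agree i ≤-refl) bounded ,
    λ d 2≤d d≤i σ′xi≡d →
      let (j , j<i , σxj≡d-1) = predecessor d 2≤d d≤i (trans (cong val (agree i ≤-refl)) σ′xi≡d)
      in j , j<i , trans (cong val (sym (agree j (<⇒≤ (≤-pred j<i))))) σxj≡d-1

  GoodAt-intro : ∀ (σ : X → Fin n) i k → k ≤ toℕ i → toℕ (σ (x i)) ≤ k →
                 (∀ w → w < k → ∃ λ j → toℕ j < toℕ i × toℕ (σ (x j)) ≡ w) →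
                 GoodAt σ x i
  GoodAt-intro σ i k k≤i σxi≤k earlier = s≤s (≤-trans σxi≤k k≤i) , predecessor
    where
    predecessor : (d : ℕ) → 2 ≤ d → d ≤ val i → val (σ (x i)) ≡ d →
                  ∃ λ (j : Fin m) → (val j < val i) × (val (σ (x j)) ≡ d ∸ 1)
    predecessor (suc (suc e)) (s≤s (s≤s _)) _ σxi≡d =
      let (j , j<i , σxj≡e) = earlier e (subst (_≤ k) (suc-injective σxi≡d) σxi≤k)
      in j , s≤s j<i , cong suc σxj≡e

module FirstOccurrence {n m : ℕ} (y : Fin m → Fin n) where

  -- Labels are 0-based (toℕ), while Good speaks of 1-based values (val).
  record Labelling (t : ℕ) : Set where
    field
      π : Permutation′ n
      count : ℕ
      count≤t : count ≤ t
      seen-below : ∀ j → toℕ j < t → toℕ (π ⟨$⟩ʳ y j) < count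
      seen-onto : ∀ w → w < count → ∃ λ j → toℕ j < t × toℕ (π ⟨$⟩ʳ y j) ≡ w
      good : ∀ i → toℕ i < t → GoodAt (π ⟨$⟩ʳ_) y i

  empty : Labelling 0
  empty = record
    { π = Perm.id ; count = 0 ; count≤t = z≤n
    ; seen-below = λ _ () ; seen-onto = λ _ () ; good = λ _ () }

  module Extend {t} (t<m : t < m) (L : Labelling t) where
    open Labelling L

    i : Fin m
    i = fromℕ< t<m

    i≡t : toℕ i ≡ t
    i≡t = toℕ-fromℕ< t<m

    before-or-at : ∀ {j} → toℕ j < suc t → toℕ j < t ⊎ j ≡ i
    before-or-at j<1+t =
      map₂ (λ j≡t → toℕ-injective (trans j≡t (sym i≡t))) (m<1+n⇒m<n∨m≡n j<1+t)

    seen-before-i : ∀ w → w < count → ∃ λ j → toℕ j < toℕ i × toℕ (π ⟨$⟩ʳ y j) ≡ w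
    seen-before-i w w<count =
      let (j , j<t , πyj≡w) = seen-onto w w<count
      in j , subst (toℕ j <_) (sym i≡t) j<t , πyj≡w

    count≤i : count ≤ toℕ i
    count≤i = subst (count ≤_) (sym i≡t) count≤t

    seen : toℕ (π ⟨$⟩ʳ y i) < count → Labelling (suc t)
    seen πyi<count = record
      { π = π ; count = count ; count≤t = m≤n⇒m≤1+n count≤t
      ; seen-below = seen-below′
      ; seen-onto = λ w w<count →
          let (j , j<t , πyj≡w) = seen-onto w w<count in j , m<n⇒m<1+n j<t , πyj≡w
      ; good = good′ }
      where
      seen-below′ : ∀ j → toℕ j < suc t → toℕ (π ⟨$⟩ʳ y j) < count
      seen-below′ j j<1+t with before-or-at j<1+t
      ... | inj₁ j<t = seen-below j j<t
      ... | inj₂ refl = πyi<count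

      good′ : ∀ j → toℕ j < suc t → GoodAt (π ⟨$⟩ʳ_) y j
      good′ j j<1+t with before-or-at j<1+t
      ... | inj₁ j<t = good j j<t
      ... | inj₂ refl = GoodAt-intro y (π ⟨$⟩ʳ_) i count count≤i (<⇒≤ πyi<count) seen-before-i

    new : ¬ toℕ (π ⟨$⟩ʳ y i) < count → Labelling (suc t)
    new πyi≮count = record
      { π = π′ ; count = suc count ; count≤t = s≤s count≤t
      ; seen-below = seen-below′
      ; seen-onto = seen-onto′
      ; good = good′ }
      where
      a : Fin n
      a = π ⟨$⟩ʳ y i

      count≤a : count ≤ toℕ a
      count≤a = ≮⇒≥ πyi≮count

      next : Fin n
      next = fromℕ< (≤-<-trans count≤a (toℕ<n a))

      next≡count : toℕ next ≡ count
      next≡count = toℕ-fromℕ< _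

      π′ : Permutation′ n
      π′ = π ∘ₚ transpose a next

      π′yi≡count : toℕ (π′ ⟨$⟩ʳ y i) ≡ count
      π′yi≡count = trans (cong toℕ (transpose-sends a next)) next≡count

      unchanged : ∀ j → toℕ j < t → π ⟨$⟩ʳ y j ≡ π′ ⟨$⟩ʳ y j
      unchanged j j<t = sym (transpose-fixes
        (λ πyj≡a → <⇒≱ (seen-below j j<t) (subst (λ z → count ≤ toℕ z) (sym πyj≡a) count≤a))
        (λ πyj≡next → <-irrefl (trans (cong toℕ πyj≡next) next≡count) (seen-below j j<t)))

      seen-onto-old : ∀ w → w < count → ∃ λ j → toℕ j < t × toℕ (π′ ⟨$⟩ʳ y j) ≡ w
      seen-onto-old w w<count =
        let (j , j<t , πyj≡w) = seen-onto w w<count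
        in j , j<t , trans (cong toℕ (sym (unchanged j j<t))) πyj≡w

      seen-below′ : ∀ j → toℕ j < suc t → toℕ (π′ ⟨$⟩ʳ y j) < suc count
      seen-below′ j j<1+t with before-or-at j<1+t
      ... | inj₁ j<t = subst (λ z → toℕ z < suc count) (unchanged j j<t) (m<n⇒m<1+n (seen-below j j<t))
      ... | inj₂ refl = s≤s (subst (_≤ count) (sym π′yi≡count) ≤-refl)

      seen-onto′ : ∀ w → w < suc count → ∃ λ j → toℕ j < suc t × toℕ (π′ ⟨$⟩ʳ y j) ≡ w
      seen-onto′ w w<1+count with m<1+n⇒m<n∨m≡n w<1+count
      ... | inj₁ w<count = let (j , j<t , π′yj≡w) = seen-onto-old w w<count in j , m<n⇒m<1+n j<t , π′yj≡w
      ... | inj₂ refl = i , subst (_< suc t) (sym i≡t) ≤-refl , π′yi≡count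

      good′ : ∀ j → toℕ j < suc t → GoodAt (π′ ⟨$⟩ʳ_) y j
      good′ j j<1+t with before-or-at j<1+t
      ... | inj₁ j<t = GoodAt-cong y (π ⟨$⟩ʳ_) (π′ ⟨$⟩ʳ_) j (λ k k≤j → unchanged k (≤-<-trans k≤j j<t)) (good j j<t)
      ... | inj₂ refl =
        GoodAt-intro y (π′ ⟨$⟩ʳ_) i count count≤i (subst (_≤ count) (sym π′yi≡count) ≤-refl)
          (λ w w<count → let (j , j<t , π′yj≡w) = seen-onto-old w w<count
                         in j , subst (toℕ j <_) (sym i≡t) j<t , π′yj≡w)

    extend : Labelling (suc t)
    extend with toℕ (π ⟨$⟩ʳ y i) <? count
    ... | yes πyi<count = seen πyi<count
    ... | no πyi≮count = new πyi≮count

  labelling : ∀ t → t ≤ m → Labelling t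
  labelling zero _ = empty
  labelling (suc t) t<m = Extend.extend t<m (labelling t (≤-trans (n≤1+n t) t<m))

mainTheorem2 : ∀ {a} (X : Set a) (n : ℕ) → X ⤖ Fin n →
    (m : ℕ) (x : Fin m → X) →
    ∃ λ (σ : X ⤖ Fin n) → Good (Bijection.to σ) x
mainTheorem2 X n f m x = ↔⇒⤖ π ⤖-∘ f , λ i → good i (toℕ<n i)
  where
  open FirstOccurrence (λ i → Bijection.to f (x i))
  open Labelling (labelling m ≤-refl)
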